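{- Let $T \in U' \otimes V' \otimes W'$ and $S \in U \otimes V \otimes W$ be tensors over a field $\mathbb{F}$, and let $A:U\to U'$, $B:V\to V'$, $C:W\to W'$ be linear maps with $T=(A\otimes B\otimes C)S$. Let $C^\perp \subseteq W^\vee$ be the subspace of linear functionals $f\colon W\to\mathbb{F}$ with $(A\otimes B\otimes f)S=0$. For any subspace $C'\subseteq C^\perp$ define \[ A' = \{ u \in U^\vee : (u \otimes B \otimes g)S = 0 \text{ for all } g\in C'\},\qquad B' = \{ v \in V^\vee : (A \otimes v \otimes g)S = 0 \text{ for all } g\in C'\}. \] Then $T\oplus T' \trianglelefteq S$, where $T'=(A'\otimes B'\otimes C')S$.
   Context: $U^\vee$ denotes the dual space of $U$. For $f\in W^\vee$, $(A\otimes B\otimes f)S$ is an element of $U'\otimes V'\otimes\mathbb{F}\cong U'\otimes V'$, and similarly for functionals in other modes. A subspace $X\subseteq U^\vee$ of dimension $k$ is regarded as the linear map $U\to\mathbb{F}^k$, $u\mapsto (f_1(u),\dots,f_k(u))$ for a basis $f_1,\dots,f_k$ of $X$; thus $T'=(A'\otimes B'\otimes C')S$ is a tensor in $\mathbb{F}^{\dim A'}\otimes\mathbb{F}^{\dim B'}\otimes\mathbb{F}^{\dim C'}$, well defined up to isomorphism. $T\oplus T'$ is the direct sum of tensors. A degeneration $T\trianglelefteq S$ means there are linear maps with entries rational functions in an indeterminate $\lambda$ such that applying them to $S$ gives $T+O(\lambda)$ in the Laurent expansion (no negative powers of $\lambda$, constant term $T$). -}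

module Defs where

open import Level using (_⊔_)
open import Algebra.Bundles using (CommutativeRing)
open import Data.Nat as ℕ using (ℕ)
open import Data.Fin using (Fin; toℕ; splitAt)
open import Data.Bool using (if_then_else_)
open import Data.Sum using (inj₁; inj₂)
open import Data.Product using (Σ; ∃; _×_)
open import Relation.Nullary using (¬_)

-- U = F^a etc.  A tensor in F^a ⊗ F^b ⊗ F^c is a function Fin a → Fin b → Fin c → F.
-- A linear map F^n → F^m is an m×n matrix  Mat m n.
-- A family of k functionals on F^n is a k×n matrix (row i = i-th functional); as in
-- the paper's convention it is the linear map F^n → F^k, u ↦ (f_1(u), …, f_k(u)).
module LinAlg {c ℓ} (R : CommutativeRing c ℓ) where
  open CommutativeRing R
  open import Algebra.Properties.Monoid.Sum +-monoid using (sum)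

  IsField : Set (c ⊔ ℓ)
  IsField = (¬ (1# ≈ 0#)) × (∀ x → ¬ (x ≈ 0#) → ∃ λ y → (x * y) ≈ 1#)

  Tensor3 : ℕ → ℕ → ℕ → Set c
  Tensor3 a b c′ = Fin a → Fin b → Fin c′ → Carrier

  Mat : ℕ → ℕ → Set c
  Mat m n = Fin m → Fin n → Carrier

  Functional : ℕ → Set c
  Functional n = Fin n → Carrier

  asMat : ∀ {n} → Functional n → Mat 1 n
  asMat f _ = f

  apply3 : ∀ {a b c′ a′ b′ c″} → Mat a′ a → Mat b′ b → Mat c″ c′ →
           Tensor3 a b c′ → Tensor3 a′ b′ c″
  apply3 A B C S i j k =
    sum λ p → sum λ q → sum λ r → A i p * (B j q * (C k r * S p q r))

  _≈T_ : ∀ {a b c′} → Tensor3 a b c′ → Tensor3 a b c′ → Set ℓ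
  T ≈T T′ = ∀ i j k → T i j k ≈ T′ i j k

  IsZeroT : ∀ {a b c′} → Tensor3 a b c′ → Set ℓ
  IsZeroT T = ∀ i j k → T i j k ≈ 0#

  lincomb : ∀ {k n} → (Fin k → Carrier) → Mat k n → Functional n
  lincomb x G j = sum λ i → x i * G i j

  InSpan : ∀ {k n} → Functional n → Mat k n → Set (c ⊔ ℓ)
  InSpan f G = ∃ λ x → ∀ j → f j ≈ lincomb x G j

  LinIndep : ∀ {k n} → Mat k n → Set (c ⊔ ℓ)
  LinIndep G = ∀ x → (∀ j → lincomb x G j ≈ 0#) → ∀ i → x i ≈ 0#

  IsBasisOf : ∀ {k n} → Mat k n → (Functional n → Set (c ⊔ ℓ)) → Set (c ⊔ ℓ)
  IsBasisOf G P = LinIndep G × (∀ i → P (G i)) × (∀ f → P f → InSpan f G)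

  _⊕T_ : ∀ {a b c′ a′ b′ c″} → Tensor3 a b c′ → Tensor3 a′ b′ c″ →
         Tensor3 (a ℕ.+ a′) (b ℕ.+ b′) (c′ ℕ.+ c″)
  _⊕T_ {a} {b} {c′} T T′ i j k with splitAt a i | splitAt b j | splitAt c′ k
  ... | inj₁ i′ | inj₁ j′ | inj₁ k′ = T i′ j′ k′
  ... | inj₂ i′ | inj₂ j′ | inj₂ k′ = T′ i′ j′ k′
  ... | _ | _ | _ = 0#

  -- The maps have Laurent-polynomial entries in λ:
  -- A(λ) = Σ_{t<K} A t · λ^(t - N), and similarly B(λ), C(λ).
  -- coeffAt A B C S d is the coefficient of λ^(d - 3N) in (A(λ) ⊗ B(λ) ⊗ C(λ)) S.
  coeffAt : ∀ {K a b c′ m n o} → (Fin K → Mat m a) → (Fin K → Mat n b) →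
            (Fin K → Mat o c′) → Tensor3 a b c′ → ℕ → Tensor3 m n o
  coeffAt A B C S d i j k =
    sum λ t₁ → sum λ t₂ → sum λ t₃ →
      if (toℕ t₁ ℕ.+ toℕ t₂ ℕ.+ toℕ t₃) ℕ.≡ᵇ d
        then apply3 (A t₁) (B t₂) (C t₃) S i j k
        else 0#

  -- T ⊴ S : no negative powers of λ, and constant term T.
  _⊴_ : ∀ {m n o a b c′} → Tensor3 m n o → Tensor3 a b c′ → Set (c ⊔ ℓ)
  _⊴_ {m} {n} {o} {a} {b} {c′} T S =
    ∃ λ (N : ℕ) → ∃ λ (K : ℕ) →
    Σ (Fin K → Mat m a) λ A → Σ (Fin K → Mat n b) λ B → Σ (Fin K → Mat o c′) λ C →
      (∀ d → d ℕ.< 3 ℕ.* N → IsZeroT (coeffAt A B C S d))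
      × (coeffAt A B C S (3 ℕ.* N) ≈T T)

{-# OPTIONS --safe #-}
-- Degenerate along A(λ) = λ⁻¹A ⊕ A′, B(λ) = B ⊕ λB′, C(λ) = λC ⊕ λ⁻¹C′.  The block of
-- (A(λ) ⊗ B(λ) ⊗ C(λ))S cut out by rows of X ∈ {A, A′}, Y ∈ {B, B′}, Z ∈ {C, C′} is
-- (X ⊗ Y ⊗ Z)S times a single power of λ.  The blocks (A,B,C) and (A′,B′,C′) carry λ⁰ and
-- give T ⊕ T′.  The only blocks with a negative power are (A,B,C′), (A′,B,C′) and (A,B′,C′),
-- and they vanish because C′ ⊆ C^⊥ and by the definition of A′ and B′; all other blocks
-- carry positive powers of λ.
module Submission where

open import Level using (Level)
open import Algebra.Bundles using (CommutativeRing)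
open import Data.Bool using (true; false; if_then_else_)
open import Data.Fin using (Fin; zero; toℕ; splitAt; punchIn; _≟_)
open import Data.Fin.Patterns using (0F; 1F; 2F)
open import Data.Fin.Properties using (punchInᵢ≢i)
open import Data.Nat as ℕ using (ℕ; s≤s)
open import Data.Product using (_,_)
open import Data.Sum using (inj₁; inj₂)
open import Data.Vec.Functional using (_++_; replicate)
open import Relation.Nullary using (Dec; yes; no; does; contradiction)
open import Relation.Nullary.Decidable using (dec-true)
open import Relation.Binary.PropositionalEquality as ≡ using (_≢_)

open import Defs

module Degeneration {c ℓ} (R : CommutativeRing c ℓ) where
  open CommutativeRing R hiding (zero)
  open import Algebra.Properties.Semiring.Sum semiring using (sum; sum-remove; sum-cong-≋; sum-replicate-zero)
  open import Relation.Binary.Reasoning.Setoid setoid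
  open LinAlg R

  if-when : ∀ {p} {P : Set p} (P? : Dec P) {x y} → P → (if does P? then x else y) ≈ x
  if-when P? p = reflexive (≡.cong (if_then _ else _) (dec-true P? p))

  if-unless : ∀ {p} {P : Set p} (P? : Dec P) {x} → (P → x ≈ 0#) → (if does P? then x else 0#) ≈ 0#
  if-unless (yes p) x≈0 = x≈0 p
  if-unless (no _) _   = refl

  sum-zero : ∀ {n} {f : Fin n → Carrier} → (∀ i → f i ≈ 0#) → sum f ≈ 0#
  sum-zero {n} f≈0 = trans (sum-cong-≋ f≈0) (sum-replicate-zero n)

  sum-supported : ∀ {n} (f : Fin n → Carrier) τ → (∀ t → t ≢ τ → f t ≈ 0#) → sum f ≈ f τ
  sum-supported {ℕ.suc n} f τ f≈0 = begin
    sum f                             ≈⟨ sum-remove f ⟩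
    f τ + sum (λ j → f (punchIn τ j)) ≈⟨ +-congˡ (sum-zero λ j → f≈0 (punchIn τ j) (punchInᵢ≢i τ j)) ⟩
    f τ + 0#                          ≈⟨ +-identityʳ (f τ) ⟩
    f τ                               ∎

  row-InSpan : ∀ {k n} (G : Mat k n) r → InSpan (G r) G
  row-InSpan G r = δ , λ j → sym (begin
    sum (λ i → δ i * G i j) ≈⟨ sum-supported _ r (λ i i≢r →
                                 trans (*-congʳ (if-unless (i ≟ r) λ i≡r → contradiction i≡r i≢r)) (zeroˡ _)) ⟩
    δ r * G r j             ≈⟨ trans (*-congʳ (if-when (r ≟ r) ≡.refl)) (*-identityˡ _) ⟩
    G r j                   ∎)
    where
    δ : Fin _ → Carrier
    δ i = if does (i ≟ r) then 1# else 0#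

  _⟨_,_,_⟩ : ∀ {a b c′} → Tensor3 a b c′ → Functional a → Functional b → Functional c′ → Carrier
  S ⟨ f , g , h ⟩ = apply3 (asMat f) (asMat g) (asMat h) S zero zero zero

  module _ {a b c′} (S : Tensor3 a b c′) {f : Functional a} {g : Functional b} {h : Functional c′} where

    ⟨⟩-cong : ∀ {f′ g′ h′} → (∀ p → f p ≈ f′ p) → (∀ q → g q ≈ g′ q) → (∀ r → h r ≈ h′ r) →
              S ⟨ f , g , h ⟩ ≈ S ⟨ f′ , g′ , h′ ⟩
    ⟨⟩-cong f≈ g≈ h≈ =
      sum-cong-≋ λ p → sum-cong-≋ λ q → sum-cong-≋ λ r → *-cong (f≈ p) (*-cong (g≈ q) (*-congʳ (h≈ r)))

    ⟨⟩-zero : (∀ p q r → f p * (g q * (h r * S p q r)) ≈ 0#) → S ⟨ f , g , h ⟩ ≈ 0#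
    ⟨⟩-zero terms≈0 = sum-zero λ p → sum-zero λ q → sum-zero λ r → terms≈0 p q r

    ⟨⟩-zero₁ : (∀ p → f p ≈ 0#) → S ⟨ f , g , h ⟩ ≈ 0#
    ⟨⟩-zero₁ f≈0 = ⟨⟩-zero λ p q r → trans (*-congʳ (f≈0 p)) (zeroˡ _)

    ⟨⟩-zero₂ : (∀ q → g q ≈ 0#) → S ⟨ f , g , h ⟩ ≈ 0#
    ⟨⟩-zero₂ g≈0 = ⟨⟩-zero λ p q r → trans (*-congˡ (trans (*-congʳ (g≈0 q)) (zeroˡ _))) (zeroʳ _)

    ⟨⟩-zero₃ : (∀ r → h r ≈ 0#) → S ⟨ f , g , h ⟩ ≈ 0#
    ⟨⟩-zero₃ h≈0 = ⟨⟩-zero λ p q r →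
      trans (*-congˡ (trans (*-congˡ (trans (*-congʳ (h≈0 r)) (zeroˡ _))) (zeroʳ _))) (zeroʳ _)

  -- Coefficient family, in the sense of coeffAt, of the matrix whose i-th row is λ^(e i − N) · X i.
  scaleRows : ∀ {K m n} → (Fin m → Fin K) → Mat m n → Fin K → Mat m n
  scaleRows e X t i p = if does (e i ≟ t) then X i p else 0#

  module _ {K m n} (e : Fin m → Fin K) (X : Mat m n) where

    scaleRows-at : ∀ i p → scaleRows e X (e i) i p ≈ X i p
    scaleRows-at i p = if-when (e i ≟ e i) ≡.refl

    scaleRows-off : ∀ t i → t ≢ e i → ∀ p → scaleRows e X t i p ≈ 0#
    scaleRows-off t i t≢ei p = if-unless (e i ≟ t) λ ei≡t → contradiction (≡.sym ei≡t) t≢ei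

  weight : ∀ {K m n o} → (Fin m → Fin K) → (Fin n → Fin K) → (Fin o → Fin K) → Fin m → Fin n → Fin o → ℕ
  weight eX eY eZ i j k = toℕ (eX i) ℕ.+ toℕ (eY j) ℕ.+ toℕ (eZ k)

  module _ {K m n o a b c′} (S : Tensor3 a b c′) {X : Mat m a} {Y : Mat n b} {Z : Mat o c′}
           (eX : Fin m → Fin K) (eY : Fin n → Fin K) (eZ : Fin o → Fin K) where

    coeffAt-scaleRows : ∀ d i j k →
      coeffAt (scaleRows eX X) (scaleRows eY Y) (scaleRows eZ Z) S d i j k
        ≈ (if weight eX eY eZ i j k ℕ.≡ᵇ d then S ⟨ X i , Y j , Z k ⟩ else 0#)
    coeffAt-scaleRows d i j k = begin
      sum (λ t₁ → sum λ t₂ → sum λ t₃ → term t₁ t₂ t₃)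
        ≈⟨ sum-supported _ (eX i) (λ t₁ t₁≢ → sum-zero λ t₂ → sum-zero λ t₃ →
             term-zero t₁ t₂ t₃ (⟨⟩-zero₁ S (scaleRows-off eX X t₁ i t₁≢))) ⟩
      sum (λ t₂ → sum λ t₃ → term (eX i) t₂ t₃)
        ≈⟨ sum-supported _ (eY j) (λ t₂ t₂≢ → sum-zero λ t₃ →
             term-zero (eX i) t₂ t₃ (⟨⟩-zero₂ S (scaleRows-off eY Y t₂ j t₂≢))) ⟩
      sum (λ t₃ → term (eX i) (eY j) t₃)
        ≈⟨ sum-supported _ (eZ k) (λ t₃ t₃≢ →
             term-zero (eX i) (eY j) t₃ (⟨⟩-zero₃ S (scaleRows-off eZ Z t₃ k t₃≢))) ⟩
      term (eX i) (eY j) (eZ k)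
        ≈⟨ term-at-exponents ⟩
      (if weight eX eY eZ i j k ℕ.≡ᵇ d then S ⟨ X i , Y j , Z k ⟩ else 0#) ∎
      where
      term : Fin K → Fin K → Fin K → Carrier
      term t₁ t₂ t₃ = if (toℕ t₁ ℕ.+ toℕ t₂ ℕ.+ toℕ t₃) ℕ.≡ᵇ d
        then S ⟨ scaleRows eX X t₁ i , scaleRows eY Y t₂ j , scaleRows eZ Z t₃ k ⟩ else 0#

      term-zero : ∀ t₁ t₂ t₃ →
        S ⟨ scaleRows eX X t₁ i , scaleRows eY Y t₂ j , scaleRows eZ Z t₃ k ⟩ ≈ 0# → term t₁ t₂ t₃ ≈ 0#
      term-zero t₁ t₂ t₃ ⟨⟩≈0 = if-unless (toℕ t₁ ℕ.+ toℕ t₂ ℕ.+ toℕ t₃ ℕ.≟ d) λ _ → ⟨⟩≈0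

      term-at-exponents :
        term (eX i) (eY j) (eZ k) ≈ (if weight eX eY eZ i j k ℕ.≡ᵇ d then S ⟨ X i , Y j , Z k ⟩ else 0#)
      term-at-exponents with weight eX eY eZ i j k ℕ.≡ᵇ d
      ... | true  = ⟨⟩-cong S (scaleRows-at eX X i) (scaleRows-at eY Y j) (scaleRows-at eZ Z k)
      ... | false = refl

    ⊴-scaleRows : ∀ N {T : Tensor3 m n o} →
      (∀ i j k → weight eX eY eZ i j k ℕ.< 3 ℕ.* N → S ⟨ X i , Y j , Z k ⟩ ≈ 0#) →
      (∀ i j k → T i j k ≈ (if weight eX eY eZ i j k ℕ.≡ᵇ 3 ℕ.* N then S ⟨ X i , Y j , Z k ⟩ else 0#)) →
      T ⊴ S
    ⊴-scaleRows N {T} low≈0 T≈ =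
      N , K , scaleRows eX X , scaleRows eY Y , scaleRows eZ Z , low-coeffs≈0 , const-coeff≈T
      where
      low-coeffs≈0 : ∀ d → d ℕ.< 3 ℕ.* N →
                     IsZeroT (coeffAt (scaleRows eX X) (scaleRows eY Y) (scaleRows eZ Z) S d)
      low-coeffs≈0 d d<3N i j k = trans (coeffAt-scaleRows d i j k)
        (if-unless (weight eX eY eZ i j k ℕ.≟ d) λ w≡d →
           low≈0 i j k (≡.subst (ℕ._< 3 ℕ.* N) (≡.sym w≡d) d<3N))

      const-coeff≈T : coeffAt (scaleRows eX X) (scaleRows eY Y) (scaleRows eZ Z) S (3 ℕ.* N) ≈T T
      const-coeff≈T i j k = trans (coeffAt-scaleRows (3 ℕ.* N) i j k) (sym (T≈ i j k))

  ⊕T-⊴ : ∀ {a b c′ a′ b′ c″ k p q} {S : Tensor3 a b c′} {T : Tensor3 a′ b′ c″}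
           {A : Mat a′ a} {B : Mat b′ b} {C : Mat c″ c′} {A′ : Mat p a} {B′ : Mat q b} {C′ : Mat k c′} →
    T ≈T apply3 A B C S →
    (∀ i j r → S ⟨ A i , B j , C′ r ⟩ ≈ 0#) →
    (∀ i j r → S ⟨ A′ i , B j , C′ r ⟩ ≈ 0#) →
    (∀ i j r → S ⟨ A i , B′ j , C′ r ⟩ ≈ 0#) →
    (T ⊕T apply3 A′ B′ C′ S) ⊴ S
  ⊕T-⊴ {a′ = a′} {b′} {c″} {k} {p} {q} {S} {T} {A} {B} {C} {A′} {B′} {C′}
       T≈ABC ABC′≈0 A′BC′≈0 AB′C′≈0 =
    ⊴-scaleRows S eA eB eC 1 negative≈0 constant≈
    where
    -- with N = 1 the index t stands for λ^(t − 1)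
    eA : Fin (a′ ℕ.+ p) → Fin 3
    eA = replicate a′ 0F ++ replicate p 1F
    eB : Fin (b′ ℕ.+ q) → Fin 3
    eB = replicate b′ 1F ++ replicate q 2F
    eC : Fin (c″ ℕ.+ k) → Fin 3
    eC = replicate c″ 2F ++ replicate k 0F

    negative≈0 : ∀ i j k → weight eA eB eC i j k ℕ.< 3 → S ⟨ (A ++ A′) i , (B ++ B′) j , (C ++ C′) k ⟩ ≈ 0#
    negative≈0 i j k with splitAt a′ i | splitAt b′ j | splitAt c″ k
    ... | inj₁ i | inj₁ j | inj₂ r = λ _ → ABC′≈0 i j r
    ... | inj₂ i | inj₁ j | inj₂ r = λ _ → A′BC′≈0 i j r
    ... | inj₁ i | inj₂ j | inj₂ r = λ _ → AB′C′≈0 i j r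
    ... | inj₁ _ | inj₁ _ | inj₁ _ = λ { (s≤s (s≤s (s≤s ()))) }
    ... | inj₂ _ | inj₂ _ | inj₂ _ = λ { (s≤s (s≤s (s≤s ()))) }
    ... | inj₂ _ | inj₁ _ | inj₁ _ = λ { (s≤s (s≤s (s≤s ()))) }
    ... | inj₁ _ | inj₂ _ | inj₁ _ = λ { (s≤s (s≤s (s≤s ()))) }
    ... | inj₂ _ | inj₂ _ | inj₁ _ = λ { (s≤s (s≤s (s≤s ()))) }

    constant≈ : ∀ i j k → (T ⊕T apply3 A′ B′ C′ S) i j k
      ≈ (if weight eA eB eC i j k ℕ.≡ᵇ 3 then S ⟨ (A ++ A′) i , (B ++ B′) j , (C ++ C′) k ⟩ else 0#)
    constant≈ i j k with splitAt a′ i | splitAt b′ j | splitAt c″ k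
    ... | inj₁ i | inj₁ j | inj₁ k = T≈ABC i j k
    ... | inj₂ i | inj₂ j | inj₂ k = refl
    ... | inj₁ _ | inj₁ _ | inj₂ _ = refl
    ... | inj₁ _ | inj₂ _ | inj₁ _ = refl
    ... | inj₁ _ | inj₂ _ | inj₂ _ = refl
    ... | inj₂ _ | inj₁ _ | inj₁ _ = refl
    ... | inj₂ _ | inj₁ _ | inj₂ _ = refl
    ... | inj₂ _ | inj₂ _ | inj₁ _ = refl

theorem5p1 : ∀ {c ℓ : Level} (R : CommutativeRing c ℓ) → let open LinAlg R in
    IsField →
    ∀ {a b c′ a′ b′ c″ : ℕ}
      (S : Tensor3 a b c′) (T : Tensor3 a′ b′ c″)
      (A : Mat a′ a) (B : Mat b′ b) (C : Mat c″ c′) →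
      T ≈T apply3 A B C S →
    -- C′ ⊆ C^⊥ given by a basis (rows of C′)
    ∀ {k : ℕ} (C′ : Mat k c′) →
      LinIndep C′ →
      (∀ r → IsZeroT (apply3 A B (asMat (C′ r)) S)) →
    -- A′ and B′ given by bases
    ∀ {p q : ℕ} (A′ : Mat p a) (B′ : Mat q b) →
      IsBasisOf A′ (λ u → ∀ g → InSpan g C′ → IsZeroT (apply3 (asMat u) B (asMat g) S)) →
      IsBasisOf B′ (λ v → ∀ g → InSpan g C′ → IsZeroT (apply3 A (asMat v) (asMat g) S)) →
      (T ⊕T apply3 A′ B′ C′ S) ⊴ S
theorem5p1 R _ S T A B C T≈ABC C′ _ C′⊥ A′ B′ (_ , A′⊥ , _) (_ , B′⊥ , _) =
  ⊕T-⊴ T≈ABC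
    (λ i j r → C′⊥ r i j zero)
    (λ i j r → A′⊥ i (C′ r) (row-InSpan C′ r) zero j zero)
    (λ i j r → B′⊥ j (C′ r) (row-InSpan C′ r) i zero zero)
  where open Degeneration R
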